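{- Let $n$ be a composite integer which is not the square of a prime, and let $u$ be a vertex of $\Upsilon_n$. Then $\deg(u)=\pi(u)$ if $n\mid u^2$, and $\deg(u)=\pi(u)+1$ if $n\nmid u^2$.
   Context: For an integer $m\ge1$, a proper divisor of $m$ is an integer $d$ with $1<d<m$ and $d\mid m$; $\pi(m)$ denotes the number of proper divisors of $m$. The proper divisor graph $\Upsilon_n$ is the simple graph whose vertices are the proper divisors of $n$, two distinct vertices $u,v$ being adjacent iff $n\mid uv$. -}

module Defs where

open import Data.Nat using (ℕ; suc; _*_; _<_; _<?_)
open import Data.Nat.Properties using (_≟_)
open import Data.Nat.Divisibility using (_∣_; _∣?_)
open import Data.List using (List; filter; length; upTo)
open import Data.Product using (_×_)
open import Relation.Nullary using (¬_)
open import Relation.Nullary.Decidable using (_×-dec_; ¬?)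

ProperDivisor : ℕ → ℕ → Set
ProperDivisor m d = 1 < d × d < m × d ∣ m

properDivisors : ℕ → List ℕ
properDivisors m = filter (λ d → (1 <? d) ×-dec ((d <? m) ×-dec (d ∣? m))) (upTo m)

π : ℕ → ℕ
π m = length (properDivisors m)

-- adjacency in the proper divisor graph Υ_n (vertices are proper divisors of n)
Adjacent : ℕ → ℕ → ℕ → Set
Adjacent n u v = ¬ (u ≡ v) × n ∣ u * v
  where open import Relation.Binary.PropositionalEquality using (_≡_)

deg : ℕ → ℕ → ℕ
deg n u = length (filter (λ v → ¬? (u ≟ v) ×-dec (n ∣? (u * v))) (properDivisors n))

-- Write n = u q. A proper divisor v of n is adjacent to u only if q ∣ v, say v = t q, and
-- t q is a proper divisor of n with n ∣ u (t q) exactly when t < u is 1 or a proper divisor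
-- of u: π(u) + 1 candidates. The only one to discard is v = u itself, which occurs (for
-- t = u / q) exactly when q ∣ u, that is, when n ∣ u².
module Submission where

open import Defs
open import Data.Nat using (ℕ; zero; suc; _+_; _*_; _<_; _<?_; z<s; s<s; NonZero; >-nonZero; >-nonZero⁻¹; n>1⇒nonTrivial)
open import Data.Nat.Properties
open import Data.Nat.Divisibility
open import Data.Nat.Primality using (Prime; Composite)
open import Data.List using ([]; _∷_; [_]; _++_; filter; length; upTo)
open import Data.List.Properties using (filter-accept; filter-reject; filter-++; length-++; upTo-∷ʳ)
open import Data.Product using (∃; _×_; _,_)
open import Data.Sum using (inj₁; inj₂)
open import Function using (_∘_; id)
open import Level using (0ℓ)
open import Relation.Nullary using (¬_; yes; no; contradiction)
open import Relation.Nullary.Decidable using (_×-dec_; ¬?)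
open import Relation.Unary using (Pred; Decidable; _∩_; _∪_; ∁)
open import Relation.Unary.Properties using (_∩?_; _∪?_; ∁?)
open import Relation.Binary.PropositionalEquality using (_≡_; refl; sym; trans; cong; subst; module ≡-Reasoning)

filter-∩ : ∀ {a p q} {A : Set a} {P : Pred A p} {Q : Pred A q} (P? : Decidable P) (Q? : Decidable Q) →
           ∀ xs → filter Q? (filter P? xs) ≡ filter (P? ∩? Q?) xs
filter-∩ P? Q? [] = refl
filter-∩ P? Q? (x ∷ xs) with P? x
... | no _ = filter-∩ P? Q? xs
... | yes _ with Q? x
...   | yes _ = cong (x ∷_) (filter-∩ P? Q? xs)
...   | no _ = filter-∩ P? Q? xs

count : ∀ {p} {P : Pred ℕ p} → Decidable P → ℕ → ℕ
count P? k = length (filter P? (upTo k))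

module _ {p} {P : Pred ℕ p} (P? : Decidable P) where

  count-suc : ∀ k → count P? (suc k) ≡ count P? k + length (filter P? [ k ])
  count-suc k = begin
    length (filter P? (upTo (suc k)))              ≡⟨ cong (length ∘ filter P?) (upTo-∷ʳ k) ⟨
    length (filter P? (upTo k ++ [ k ]))           ≡⟨ cong length (filter-++ P? (upTo k) [ k ]) ⟩
    length (filter P? (upTo k) ++ filter P? [ k ]) ≡⟨ length-++ (filter P? (upTo k)) ⟩
    count P? k + length (filter P? [ k ])          ∎
    where open ≡-Reasoning

  count-accept : ∀ {k} → P k → count P? (suc k) ≡ suc (count P? k)
  count-accept {k} Pk rewrite count-suc k | filter-accept P? {xs = []} Pk = +-comm (count P? k) 1

  count-reject : ∀ {k} → ¬ P k → count P? (suc k) ≡ count P? k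
  count-reject {k} ¬Pk rewrite count-suc k | filter-reject P? {xs = []} ¬Pk = +-identityʳ (count P? k)

  count-none : ∀ k → (∀ {t} → t < k → ¬ P t) → count P? k ≡ 0
  count-none zero _ = refl
  count-none (suc k) ¬P = trans (count-reject (¬P (n<1+n k))) (count-none k (¬P ∘ m<n⇒m<1+n))

  count-unique : ∀ {k t₀} → t₀ < k → P t₀ → (∀ {t} → t < k → P t → t ≡ t₀) → count P? k ≡ 1
  count-unique {suc k} t₀<1+k Pt₀ unique with m<1+n⇒m<n∨m≡n t₀<1+k
  ... | inj₁ t₀<k = trans (count-reject (λ Pk → <-irrefl (sym (unique (n<1+n k) Pk)) t₀<k))
                          (count-unique t₀<k Pt₀ (unique ∘ m<n⇒m<1+n))
  ... | inj₂ refl = trans (count-accept Pt₀)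
                          (cong suc (count-none k (λ t<k Pt → <-irrefl (unique (m<n⇒m<1+n t<k) Pt) t<k)))

  count-gap : ∀ k j → (∀ {i} → i < j → ¬ P (k + i)) → count P? (k + j) ≡ count P? k
  count-gap k zero _ = cong (count P?) (+-identityʳ k)
  count-gap k (suc j) ¬P rewrite +-suc k j =
    trans (count-reject (¬P (n<1+n j))) (count-gap k j (¬P ∘ m<n⇒m<1+n))

module _ {p q} {P : Pred ℕ p} {Q : Pred ℕ q} (P? : Decidable P) (Q? : Decidable Q) where

  count-step : ∀ {k m} → count P? k ≡ count Q? m → (P k → Q m) → (Q m → P k) →
               count P? (suc k) ≡ count Q? (suc m)
  count-step {k} {m} eq P⇒Q Q⇒P with P? k
  ... | yes Pk = trans (count-accept P? Pk) (trans (cong suc eq) (sym (count-accept Q? (P⇒Q Pk))))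
  ... | no ¬Pk = trans (count-reject P? ¬Pk) (trans eq (sym (count-reject Q? (¬Pk ∘ Q⇒P))))

  count-cong : ∀ k → (∀ {t} → t < k → P t → Q t) → (∀ {t} → t < k → Q t → P t) →
               count P? k ≡ count Q? k
  count-cong zero _ _ = refl
  count-cong (suc k) P⇒Q Q⇒P =
    count-step (count-cong k (P⇒Q ∘ m<n⇒m<1+n) (Q⇒P ∘ m<n⇒m<1+n)) (P⇒Q (n<1+n k)) (Q⇒P (n<1+n k))

  count-split : ∀ k → count P? k ≡ count (P? ∩? Q?) k + count (P? ∩? ∁? Q?) k
  count-split zero = refl
  count-split (suc k) with P? k | Q? k
  ... | yes Pk | yes Qk rewrite count-accept P? Pk | count-accept (P? ∩? Q?) (Pk , Qk)
                              | count-reject (P? ∩? ∁? Q?) (λ (_ , ¬Qk) → ¬Qk Qk) =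
    cong suc (count-split k)
  ... | yes Pk | no ¬Qk rewrite count-accept P? Pk | count-reject (P? ∩? Q?) (λ (_ , Qk) → ¬Qk Qk)
                              | count-accept (P? ∩? ∁? Q?) (Pk , ¬Qk) =
    trans (cong suc (count-split k)) (sym (+-suc _ _))
  ... | no ¬Pk | _ rewrite count-reject P? ¬Pk | count-reject (P? ∩? Q?) (λ (Pk , _) → ¬Pk Pk)
                         | count-reject (P? ∩? ∁? Q?) (λ (Pk , _) → ¬Pk Pk) =
    count-split k

  count-⊎ : (∀ {t} → P t → ¬ Q t) → ∀ k → count (P? ∪? Q?) k ≡ count P? k + count Q? k
  count-⊎ disjoint zero = refl
  count-⊎ disjoint (suc k) with P? k | Q? k
  ... | yes Pk | yes Qk = contradiction Qk (disjoint Pk)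
  ... | yes Pk | no ¬Qk rewrite count-accept (P? ∪? Q?) (inj₁ Pk) | count-accept P? Pk
                              | count-reject Q? ¬Qk =
    cong suc (count-⊎ disjoint k)
  ... | no ¬Pk | yes Qk rewrite count-accept (P? ∪? Q?) (inj₂ Qk) | count-reject P? ¬Pk
                              | count-accept Q? Qk =
    trans (cong suc (count-⊎ disjoint k)) (sym (+-suc _ _))
  ... | no ¬Pk | no ¬Qk rewrite count-reject (P? ∪? Q?) (λ { (inj₁ Pk) → ¬Pk Pk ; (inj₂ Qk) → ¬Qk Qk })
                              | count-reject P? ¬Pk | count-reject Q? ¬Qk =
    count-⊎ disjoint k

count-multiples : ∀ {p} {P : Pred ℕ p} (P? : Decidable P) q .{{_ : NonZero q}} →
                  (∀ {v} → P v → q ∣ v) → ∀ m → count P? (m * q) ≡ count (λ t → P? (t * q)) m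
count-multiples P? q P⇒q∣ zero = refl
count-multiples {P = P} P? q@(suc r) P⇒q∣ (suc m) = begin
  count P? (suc m * q)          ≡⟨ cong (count P?) (cong suc (+-comm r (m * q))) ⟩
  count P? (suc (m * q) + r)    ≡⟨ count-gap P? (suc (m * q)) r ¬P-between ⟩
  count P? (suc (m * q))        ≡⟨ count-step P? (λ t → P? (t * q)) (count-multiples P? q P⇒q∣ m) id id ⟩
  count (λ t → P? (t * q)) (suc m) ∎
  where
  open ≡-Reasoning
  ¬P-between : ∀ {i} → i < r → ¬ P (suc (m * q) + i)
  ¬P-between {i} i<r P[mq+1+i] = <⇒≱ (s<s i<r) (∣⇒≤ q∣1+i)
    where
    q∣1+i : q ∣ suc i
    q∣1+i = ∣m+n∣m⇒∣n (subst (q ∣_) (sym (+-suc (m * q) i)) (P⇒q∣ P[mq+1+i])) (n∣m*n m)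

properDivisor? : ∀ m → Decidable (ProperDivisor m)
properDivisor? m d = (1 <? d) ×-dec ((d <? m) ×-dec (d ∣? m))

adjacent? : ∀ n u → Decidable (Adjacent n u)
adjacent? n u v = ¬? (u ≟ v) ×-dec (n ∣? (u * v))

deg≡count : ∀ n u → deg n u ≡ count (properDivisor? n ∩? adjacent? n u) n
deg≡count n u = cong length (filter-∩ (properDivisor? n) (adjacent? n u) (upTo n))

OneOrProperDivisor : ℕ → Pred ℕ 0ℓ
OneOrProperDivisor u = (_≡ 1) ∪ ProperDivisor u

oneOrProperDivisor? : ∀ u → Decidable (OneOrProperDivisor u)
oneOrProperDivisor? u = (_≟ 1) ∪? properDivisor? u

oneOrProperDivisor-intro : ∀ {u t} → 0 < t → t < u → t ∣ u → OneOrProperDivisor u t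
oneOrProperDivisor-intro {t = 1} _ _ _ = inj₁ refl
oneOrProperDivisor-intro {t = suc (suc _)} _ t<u t∣u = inj₂ (s<s z<s , t<u , t∣u)

oneOrProperDivisor-pos : ∀ {u t} → OneOrProperDivisor u t → 0 < t
oneOrProperDivisor-pos (inj₁ refl) = z<s
oneOrProperDivisor-pos (inj₂ (1<t , _)) = <-trans z<s 1<t

oneOrProperDivisor-∣ : ∀ {u t} → OneOrProperDivisor u t → t ∣ u
oneOrProperDivisor-∣ {u} (inj₁ refl) = 1∣ u
oneOrProperDivisor-∣ (inj₂ (_ , _ , t∣u)) = t∣u

count-oneOrProperDivisor : ∀ {u} → 1 < u → count (oneOrProperDivisor? u) u ≡ suc (π u)
count-oneOrProperDivisor {u} 1<u = begin
  count (oneOrProperDivisor? u) u                       ≡⟨ count-⊎ (_≟ 1) (properDivisor? u) one-improper u ⟩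
  count (_≟ 1) u + count (properDivisor? u) u           ≡⟨ cong (_+ π u) (count-unique (_≟ 1) 1<u refl (λ _ t≡1 → t≡1)) ⟩
  suc (π u)                                             ∎
  where
  open ≡-Reasoning
  one-improper : ∀ {t} → t ≡ 1 → ¬ ProperDivisor u t
  one-improper refl (1<1 , _) = <-irrefl refl 1<1

module DegreeOfDivisor {u q : ℕ} (1<u : 1 < u) (1<q : 1 < q) where

  instance
    u≢0 : NonZero u
    u≢0 = >-nonZero (<-trans z<s 1<u)
    q≢0 : NonZero q
    q≢0 = >-nonZero (<-trans z<s 1<q)

  Neighbour : Pred ℕ 0ℓ
  Neighbour = ProperDivisor (u * q) ∩ Adjacent (u * q) u

  neighbour? : Decidable Neighbour
  neighbour? = properDivisor? (u * q) ∩? adjacent? (u * q) u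

  IsCofactor : Pred ℕ 0ℓ
  IsCofactor t = u ≡ t * q

  isCofactor? : Decidable IsCofactor
  isCofactor? t = u ≟ t * q

  neighbour⇒multiple : ∀ {v} → Neighbour v → q ∣ v
  neighbour⇒multiple (_ , _ , uq∣uv) = *-cancelˡ-∣ u uq∣uv

  neighbour-multiple⇒ : ∀ {t} → t < u → Neighbour (t * q) → (OneOrProperDivisor u ∩ ∁ IsCofactor) t
  neighbour-multiple⇒ {zero} _ ((() , _) , _)
  neighbour-multiple⇒ {suc _} t<u ((_ , _ , tq∣uq) , u≢tq , _) =
    oneOrProperDivisor-intro z<s t<u (*-cancelʳ-∣ q tq∣uq) , u≢tq

  neighbour-multiple⇐ : ∀ {t} → t < u → (OneOrProperDivisor u ∩ ∁ IsCofactor) t → Neighbour (t * q)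
  neighbour-multiple⇐ {t} t<u (oneOrPd , u≢tq) =
    (1<tq , *-monoˡ-< q t<u , *-monoˡ-∣ q (oneOrProperDivisor-∣ oneOrPd)) , u≢tq , *-monoʳ-∣ u (n∣m*n t)
    where
    1<tq : 1 < t * q
    1<tq = <-≤-trans 1<q (m≤n*m q t {{>-nonZero (oneOrProperDivisor-pos oneOrPd)}})

  cofactorCount : ℕ
  cofactorCount = count (oneOrProperDivisor? u ∩? isCofactor?) u

  deg+cofactorCount≡1+π : deg (u * q) u + cofactorCount ≡ suc (π u)
  deg+cofactorCount≡1+π = begin
    deg (u * q) u + cofactorCount                              ≡⟨ cong (_+ cofactorCount) deg≡ ⟩
    count (oneOrProperDivisor? u ∩? ∁? isCofactor?) u + cofactorCount
                                                               ≡⟨ +-comm _ cofactorCount ⟩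
    cofactorCount + count (oneOrProperDivisor? u ∩? ∁? isCofactor?) u
                                                               ≡⟨ count-split (oneOrProperDivisor? u) isCofactor? u ⟨
    count (oneOrProperDivisor? u) u                            ≡⟨ count-oneOrProperDivisor 1<u ⟩
    suc (π u)                                                  ∎
    where
    open ≡-Reasoning
    deg≡ : deg (u * q) u ≡ count (oneOrProperDivisor? u ∩? ∁? isCofactor?) u
    deg≡ = begin
      deg (u * q) u                                     ≡⟨ deg≡count (u * q) u ⟩
      count neighbour? (u * q)                          ≡⟨ count-multiples neighbour? q neighbour⇒multiple u ⟩
      count (λ t → neighbour? (t * q)) u                ≡⟨ count-cong _ _ u neighbour-multiple⇒ neighbour-multiple⇐ ⟩
      count (oneOrProperDivisor? u ∩? ∁? isCofactor?) u ∎

  cofactorCount-∣ : u * q ∣ u * u → cofactorCount ≡ 1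
  cofactorCount-∣ uq∣uu =
    count-unique (oneOrProperDivisor? u ∩? isCofactor?) t₀<u
      (oneOrProperDivisor-intro (>-nonZero⁻¹ t₀ {{quotient≢0 q∣u}}) t₀<u (quotient-∣ q∣u) , u≡t₀q)
      (λ {t} _ (_ , u≡tq) → *-cancelʳ-≡ t t₀ q (trans (sym u≡tq) u≡t₀q))
    where
    q∣u = *-cancelˡ-∣ u uq∣uu
    t₀ = quotient q∣u
    u≡t₀q : u ≡ t₀ * q
    u≡t₀q = m∣n⇒n≡quotient*m q∣u
    t₀<u : t₀ < u
    t₀<u = quotient-< q∣u {{n>1⇒nonTrivial 1<q}}

  cofactorCount-∤ : ¬ (u * q ∣ u * u) → cofactorCount ≡ 0
  cofactorCount-∤ uq∤uu = count-none (oneOrProperDivisor? u ∩? isCofactor?) u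
    (λ {t} _ (_ , u≡tq) → uq∤uu (subst (λ w → u * q ∣ u * w) (sym u≡tq) (*-monoʳ-∣ u (n∣m*n t))))

  deg-∣ : u * q ∣ u * u → deg (u * q) u ≡ π u
  deg-∣ uq∣uu = +-cancelʳ-≡ 1 _ _ (begin
    deg (u * q) u + 1             ≡⟨ cong (deg (u * q) u +_) (cofactorCount-∣ uq∣uu) ⟨
    deg (u * q) u + cofactorCount ≡⟨ deg+cofactorCount≡1+π ⟩
    suc (π u)                     ≡⟨ +-comm 1 (π u) ⟩
    π u + 1                       ∎)
    where open ≡-Reasoning

  deg-∤ : ¬ (u * q ∣ u * u) → deg (u * q) u ≡ suc (π u)
  deg-∤ uq∤uu = begin
    deg (u * q) u                 ≡⟨ +-identityʳ _ ⟨
    deg (u * q) u + 0             ≡⟨ cong (deg (u * q) u +_) (cofactorCount-∤ uq∤uu) ⟨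
    deg (u * q) u + cofactorCount ≡⟨ deg+cofactorCount≡1+π ⟩
    suc (π u)                     ∎
    where open ≡-Reasoning

proposition2p2 : (n : ℕ) → Composite n → ¬ (∃ λ p → Prime p × n ≡ p * p) →
    (u : ℕ) → ProperDivisor n u →
    (n ∣ u * u → deg n u ≡ π u) × (¬ (n ∣ u * u) → deg n u ≡ suc (π u))
proposition2p2 n _ _ u (1<u , u<n , u∣n) =
  subst (λ m → (m ∣ u * u → deg m u ≡ π u) × (¬ (m ∣ u * u) → deg m u ≡ suc (π u)))
        (sym (m∣n⇒n≡m*quotient u∣n))
        (deg-∣ , deg-∤)
  where open DegreeOfDivisor 1<u (quotient>1 u∣n u<n)
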